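{- Let $n\ge 1$ and let $C$ and $C'$ be $\mathbb{Z}_4$-codes of length $n$. Suppose that $D$ and $D'$ are $\mathbb{Z}_4$-codes of length $n+1$ such that $\overline{C}\cong D$ and $\overline{C'}\cong D'$. Then $C\cong C'$ if and only if $D\cong D'$.
   Context: $\mathbb{Z}_4=\{0,1,2,3\}$ is the ring of integers modulo $4$. A $\mathbb{Z}_4$-code of length $n$ is a $\mathbb{Z}_4$-submodule of $\mathbb{Z}_4^n$. Two $\mathbb{Z}_4$-codes $C,C'$ of the same length are equivalent, written $C\cong C'$, if $C'$ can be obtained from $C$ by permuting coordinates and (if necessary) changing the signs of certain coordinates, i.e. $C'=CP$ for some monomial matrix $P$ with nonzero entries in $\{1,-1\}$. For a $\mathbb{Z}_4$-code $C$ of length $n$, its trivial extension is the code $\overline{C}=\{(c,0)\mid c\in C\}$ of length $n+1$. -}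

module Defs where

open import Level using (0ℓ)
open import Data.Nat using (ℕ; suc)
open import Data.Fin using (Fin)
open import Data.Fin.Permutation using (Permutation′; _⟨$⟩ʳ_; _⟨$⟩ˡ_)
open import Data.Bool using (Bool; true; false)
open import Data.Vec using (Vec; tabulate; lookup; replicate; zipWith; map; _∷ʳ_)
open import Data.Product using (Σ; _×_; _,_; ∃)
open import Relation.Unary using (Pred)
open import Relation.Binary.PropositionalEquality using (_≡_)
open import Function.Bundles using (_⇔_)

data ℤ₄ : Set where
  z0 z1 z2 z3 : ℤ₄

_+₄_ : ℤ₄ → ℤ₄ → ℤ₄
z0 +₄ y = y
z1 +₄ z0 = z1
z1 +₄ z1 = z2
z1 +₄ z2 = z3
z1 +₄ z3 = z0
z2 +₄ z0 = z2
z2 +₄ z1 = z3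
z2 +₄ z2 = z0
z2 +₄ z3 = z1
z3 +₄ z0 = z3
z3 +₄ z1 = z0
z3 +₄ z2 = z1
z3 +₄ z3 = z2

_*₄_ : ℤ₄ → ℤ₄ → ℤ₄
z0 *₄ y = z0
z1 *₄ y = y
z2 *₄ z0 = z0
z2 *₄ z1 = z2
z2 *₄ z2 = z0
z2 *₄ z3 = z2
z3 *₄ z0 = z0
z3 *₄ z1 = z3
z3 *₄ z2 = z2
z3 *₄ z3 = z1

-₄_ : ℤ₄ → ℤ₄
-₄ z0 = z0
-₄ z1 = z3
-₄ z2 = z2
-₄ z3 = z1

Word : ℕ → Set
Word n = Vec ℤ₄ n

zeroWord : ∀ {n} → Word n
zeroWord = replicate _ z0

_⊕_ : ∀ {n} → Word n → Word n → Word n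
_⊕_ = zipWith _+₄_

_·_ : ∀ {n} → ℤ₄ → Word n → Word n
a · x = map (a *₄_) x

record IsZ4Code {n : ℕ} (C : Pred (Word n) 0ℓ) : Set where
  field
    has-zero : C zeroWord
    closed-+ : ∀ {x y} → C x → C y → C (x ⊕ y)
    closed-· : ∀ (a : ℤ₄) {x} → C x → C (a · x)

-- A sign ±1: `true` means −1, `false` means +1.
applySign : Bool → ℤ₄ → ℤ₄
applySign true a = -₄ a
applySign false a = a

-- Action of the monomial matrix P with P_{i, π i} = ε_i ∈ {1,−1}:
-- (cP)_{π i} = ε_i c_i, i.e. (cP)_j = ε_{π⁻¹ j} c_{π⁻¹ j}.
monomialAct : ∀ {n} → Permutation′ n → (Fin n → Bool) → Word n → Word n
monomialAct π ε c = tabulate (λ j → applySign (ε (π ⟨$⟩ˡ j)) (lookup c (π ⟨$⟩ˡ j)))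

_≅_ : ∀ {n} → Pred (Word n) 0ℓ → Pred (Word n) 0ℓ → Set
_≅_ {n} C C' = Σ (Permutation′ n) λ π → Σ (Fin n → Bool) λ ε →
  ∀ (y : Word n) → C' y ⇔ (∃ λ c → C c × y ≡ monomialAct π ε c)

ext : ∀ {n} → Pred (Word n) 0ℓ → Pred (Word (suc n)) 0ℓ
ext C y = ∃ λ c → C c × y ≡ (c ∷ʳ z0)

-- A monomial on length n+1 that fixes the last
--      coordinate restricts to a monomial on length n, and every monomial on
--      length n extends to one fixing the last coordinate; such a pair acts
--      compatibly on words (c , 0) (monomialAct-∷ʳ).  Conversely, if P maps
--      ext C onto ext C' then every word of ext C vanishes at the coordinate P
--      sends to the last one; swapping that coordinate with the last (on which
--      ext C also vanishes) does not change the action on ext C, and yields a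
--      monomial fixing the last coordinate (fixing-last).
--   3. Lemma 3.1 follows by chaining D ≅ ext C ≅ ext C' ≅ D' (and back).
module Submission where

open import Defs
open import Level using (0ℓ)
open import Data.Nat using (ℕ; zero; suc; _≤_)
open import Data.Fin using (Fin; zero; suc; inject₁; fromℕ; punchIn; _≟_)
open import Data.Fin.Permutation
  using (Permutation′; _⟨$⟩ʳ_; _⟨$⟩ˡ_; inverseˡ; inverseʳ; flip; _∘ₚ_;
         transpose; insert; remove; insert-punchIn; punchIn-permute)
import Data.Fin.Permutation.Components as Components
open import Data.Bool using (Bool; true; false; _xor_)
open import Data.Vec using ([]; _∷_; lookup; _∷ʳ_)
open import Data.Vec.Properties using (lookup∘tabulate; tabulate∘lookup; tabulate-cong; ∷ʳ-injectiveˡ)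
open import Data.Product using (Σ; _×_; _,_; ∃)
open import Relation.Unary using (Pred)
open import Relation.Nullary using (yes; no; contradiction)
open import Function using (_∘_)
open import Function.Bundles using (_⇔_; mk⇔; Equivalence)
open import Relation.Binary.PropositionalEquality
open ≡-Reasoning

open Equivalence using (to; from)

applySign-involutive : ∀ s x → applySign s (applySign s x) ≡ x
applySign-involutive true z0 = refl
applySign-involutive true z1 = refl
applySign-involutive true z2 = refl
applySign-involutive true z3 = refl
applySign-involutive false x = refl

applySign-xor : ∀ s t x → applySign t (applySign s x) ≡ applySign (s xor t) x
applySign-xor true  true  x = applySign-involutive true x
applySign-xor true  false x = refl
applySign-xor false true  x = refl
applySign-xor false false x = refl

applySign-zero : ∀ s → applySign s z0 ≡ z0
applySign-zero true  = refl
applySign-zero false = refl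

applySign-zero⁻¹ : ∀ s x → applySign s x ≡ z0 → x ≡ z0
applySign-zero⁻¹ s x e = begin
  x                              ≡⟨ applySign-involutive s x ⟨
  applySign s (applySign s x)    ≡⟨ cong (applySign s) e ⟩
  applySign s z0                 ≡⟨ applySign-zero s ⟩
  z0                             ∎

word-ext : ∀ {n} {x y : Word n} → (∀ j → lookup x j ≡ lookup y j) → x ≡ y
word-ext {x = x} {y} p = begin
  x                 ≡⟨ tabulate∘lookup x ⟨
  _                 ≡⟨ tabulate-cong p ⟩
  _                 ≡⟨ tabulate∘lookup y ⟩
  y                 ∎

lookup-monomialAct : ∀ {n} (π : Permutation′ n) ε c j →
  lookup (monomialAct π ε c) j ≡ applySign (ε (π ⟨$⟩ˡ j)) (lookup c (π ⟨$⟩ˡ j))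
lookup-monomialAct π ε c j = lookup∘tabulate _ j

inverseSigns : ∀ {n} → Permutation′ n → (Fin n → Bool) → Fin n → Bool
inverseSigns π ε k = ε (π ⟨$⟩ˡ k)

monomialAct-inverse : ∀ {n} (π : Permutation′ n) ε c →
  monomialAct (flip π) (inverseSigns π ε) (monomialAct π ε c) ≡ c
monomialAct-inverse π ε c = word-ext λ i → begin
  lookup (monomialAct (flip π) (inverseSigns π ε) (monomialAct π ε c)) i
    ≡⟨ lookup-monomialAct (flip π) (inverseSigns π ε) (monomialAct π ε c) i ⟩
  applySign (ε (π ⟨$⟩ˡ (π ⟨$⟩ʳ i))) (lookup (monomialAct π ε c) (π ⟨$⟩ʳ i))
    ≡⟨ cong (applySign (ε (π ⟨$⟩ˡ (π ⟨$⟩ʳ i)))) (lookup-monomialAct π ε c (π ⟨$⟩ʳ i)) ⟩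
  applySign (ε (π ⟨$⟩ˡ (π ⟨$⟩ʳ i))) (applySign (ε (π ⟨$⟩ˡ (π ⟨$⟩ʳ i))) (lookup c (π ⟨$⟩ˡ (π ⟨$⟩ʳ i))))
    ≡⟨ cong (λ k → applySign (ε k) (applySign (ε k) (lookup c k))) (inverseˡ π) ⟩
  applySign (ε i) (applySign (ε i) (lookup c i))
    ≡⟨ applySign-involutive (ε i) (lookup c i) ⟩
  lookup c i ∎

composeSigns : ∀ {n} → Permutation′ n → (Fin n → Bool) → (Fin n → Bool) → Fin n → Bool
composeSigns π₁ ε₁ ε₂ i = ε₁ i xor ε₂ (π₁ ⟨$⟩ʳ i)

monomialAct-compose : ∀ {n} (π₁ π₂ : Permutation′ n) ε₁ ε₂ c →
  monomialAct π₂ ε₂ (monomialAct π₁ ε₁ c) ≡ monomialAct (π₁ ∘ₚ π₂) (composeSigns π₁ ε₁ ε₂) c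
monomialAct-compose π₁ π₂ ε₁ ε₂ c = word-ext λ j →
  let i = π₁ ⟨$⟩ˡ (π₂ ⟨$⟩ˡ j) in begin
  lookup (monomialAct π₂ ε₂ (monomialAct π₁ ε₁ c)) j
    ≡⟨ lookup-monomialAct π₂ ε₂ (monomialAct π₁ ε₁ c) j ⟩
  applySign (ε₂ (π₂ ⟨$⟩ˡ j)) (lookup (monomialAct π₁ ε₁ c) (π₂ ⟨$⟩ˡ j))
    ≡⟨ cong (applySign (ε₂ (π₂ ⟨$⟩ˡ j))) (lookup-monomialAct π₁ ε₁ c (π₂ ⟨$⟩ˡ j)) ⟩
  applySign (ε₂ (π₂ ⟨$⟩ˡ j)) (applySign (ε₁ i) (lookup c i))
    ≡⟨ applySign-xor (ε₁ i) (ε₂ (π₂ ⟨$⟩ˡ j)) (lookup c i) ⟩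
  applySign (ε₁ i xor ε₂ (π₂ ⟨$⟩ˡ j)) (lookup c i)
    ≡⟨ cong (λ k → applySign (ε₁ i xor ε₂ k) (lookup c i)) (inverseʳ π₁) ⟨
  applySign (composeSigns π₁ ε₁ ε₂ i) (lookup c i)
    ≡⟨ lookup-monomialAct (π₁ ∘ₚ π₂) (composeSigns π₁ ε₁ ε₂) c j ⟨
  lookup (monomialAct (π₁ ∘ₚ π₂) (composeSigns π₁ ε₁ ε₂) c) j ∎

Realises : ∀ {n} → Permutation′ n → (Fin n → Bool) → Pred (Word n) 0ℓ → Pred (Word n) 0ℓ → Set
Realises π ε C C' = ∀ y → C' y ⇔ (∃ λ c → C c × y ≡ monomialAct π ε c)

image : ∀ {n} {C C' : Pred (Word n) 0ℓ} π ε → Realises π ε C C' → ∀ {c} → C c → C' (monomialAct π ε c)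
image π ε h Cc = from (h _) (_ , Cc , refl)

preimage : ∀ {n} {C C' : Pred (Word n) 0ℓ} π ε → Realises π ε C C' →
  ∀ {y} → C' y → ∃ λ c → C c × y ≡ monomialAct π ε c
preimage π ε h C'y = to (h _) C'y

≅-sym : ∀ {n} {C C' : Pred (Word n) 0ℓ} → C ≅ C' → C' ≅ C
≅-sym {C = C} (π , ε , h) = flip π , inverseSigns π ε , λ y → mk⇔
  (λ Cy → monomialAct π ε y , image π ε h Cy , sym (monomialAct-inverse π ε y))
  (λ { (c' , C'c' , refl) → let (c , Cc , c'≡) = preimage π ε h C'c' in
       subst C (sym (trans (cong (monomialAct (flip π) (inverseSigns π ε)) c'≡)
                           (monomialAct-inverse π ε c))) Cc })

≅-trans : ∀ {n} {A B C : Pred (Word n) 0ℓ} → A ≅ B → B ≅ C → A ≅ C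
≅-trans {C = C} (π₁ , ε₁ , h₁) (π₂ , ε₂ , h₂) = π₁ ∘ₚ π₂ , composeSigns π₁ ε₁ ε₂ , λ y → mk⇔
  (λ Cy → let (b , Bb , y≡) = preimage π₂ ε₂ h₂ Cy ; (a , Aa , b≡) = preimage π₁ ε₁ h₁ Bb in
     a , Aa , trans y≡ (trans (cong (monomialAct π₂ ε₂) b≡) (monomialAct-compose π₁ π₂ ε₁ ε₂ a)))
  (λ { (a , Aa , refl) → subst C (monomialAct-compose π₁ π₂ ε₁ ε₂ a) (image π₂ ε₂ h₂ (image π₁ ε₁ h₁ Aa)) })

realises-agree : ∀ {n} {C C' : Pred (Word n) 0ℓ} π ε τ ε' →
  (∀ v → C v → monomialAct τ ε' v ≡ monomialAct π ε v) →
  Realises π ε C C' → Realises τ ε' C C'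
realises-agree π ε τ ε' agree h y = mk⇔
  (λ C'y → let (v , Cv , y≡) = preimage π ε h C'y in v , Cv , trans y≡ (sym (agree v Cv)))
  (λ { (v , Cv , y≡) → from (h y) (v , Cv , trans y≡ (agree v Cv)) })

realised-vanishing : ∀ {n} {C C' : Pred (Word n) 0ℓ} π ε → Realises π ε C C' → ∀ j →
  (∀ w → C' w → lookup w j ≡ z0) → ∀ v → C v → lookup v (π ⟨$⟩ˡ j) ≡ z0
realised-vanishing π ε h j vanishes v Cv =
  applySign-zero⁻¹ (ε (π ⟨$⟩ˡ j)) _
    (trans (sym (lookup-monomialAct π ε v j)) (vanishes _ (image π ε h Cv)))

transpose-invariant : ∀ {n} {A : Set} (f : Fin n → A) a b → f a ≡ f b →
  ∀ k → f (Components.transpose a b k) ≡ f k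
transpose-invariant f a b fa≡fb k with k ≟ a
... | yes refl = sym fa≡fb
... | no _ with k ≟ b
...   | yes refl = fa≡fb
...   | no _ = refl

transpose-second : ∀ {n} (a b : Fin n) → Components.transpose a b b ≡ a
transpose-second a b with b ≟ a
... | yes b≡a = b≡a
... | no _ with b ≟ b
...   | yes _ = refl
...   | no b≢b = contradiction refl b≢b

monomialAct-swap : ∀ {n} (π : Permutation′ n) ε a b (v : Word n) → lookup v a ≡ lookup v b →
  monomialAct (transpose a b ∘ₚ π) (ε ∘ (transpose a b ⟨$⟩ʳ_)) v ≡ monomialAct π ε v
monomialAct-swap π ε a b v va≡vb = word-ext λ j → let k = π ⟨$⟩ˡ j in begin
  lookup (monomialAct (transpose a b ∘ₚ π) (ε ∘ (transpose a b ⟨$⟩ʳ_)) v) j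
    ≡⟨ lookup-monomialAct (transpose a b ∘ₚ π) (ε ∘ (transpose a b ⟨$⟩ʳ_)) v j ⟩
  applySign (ε (transpose a b ⟨$⟩ʳ (transpose a b ⟨$⟩ˡ k))) (lookup v (transpose a b ⟨$⟩ˡ k))
    ≡⟨ cong₂ (λ i x → applySign (ε i) x) (inverseʳ (transpose a b))
             (transpose-invariant (lookup v) b a (sym va≡vb) k) ⟩
  applySign (ε k) (lookup v k)
    ≡⟨ lookup-monomialAct π ε v j ⟨
  lookup (monomialAct π ε v) j ∎

data LastView {n : ℕ} : Fin (suc n) → Set where
  last  : LastView (fromℕ n)
  inner : (k : Fin n) → LastView (inject₁ k)

lastView : ∀ {n} (x : Fin (suc n)) → LastView x
lastView {zero}  zero    = last
lastView {suc n} zero    = inner zero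
lastView {suc n} (suc x) with lastView x
... | last    = last
... | inner k = inner (suc k)

lookup-∷ʳ-inject₁ : ∀ {n} (c : Word n) a k → lookup (c ∷ʳ a) (inject₁ k) ≡ lookup c k
lookup-∷ʳ-inject₁ (x ∷ c) a zero    = refl
lookup-∷ʳ-inject₁ (x ∷ c) a (suc k) = lookup-∷ʳ-inject₁ c a k

lookup-∷ʳ-last : ∀ {n} (c : Word n) a → lookup (c ∷ʳ a) (fromℕ n) ≡ a
lookup-∷ʳ-last []      a = refl
lookup-∷ʳ-last (x ∷ c) a = lookup-∷ʳ-last c a

punchIn-last : ∀ {n} (k : Fin n) → punchIn (fromℕ n) k ≡ inject₁ k
punchIn-last zero    = refl
punchIn-last (suc k) = cong suc (punchIn-last k)

ext-vanishes : ∀ {n} {C : Pred (Word n) 0ℓ} v → ext C v → lookup v (fromℕ n) ≡ z0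
ext-vanishes _ (c , _ , refl) = lookup-∷ʳ-last c z0

record Extends {n} (τ : Permutation′ (suc n)) (ε' : Fin (suc n) → Bool)
               (σ : Permutation′ n) (δ : Fin n → Bool) : Set where
  field
    fixes-last   : τ ⟨$⟩ʳ fromℕ n ≡ fromℕ n
    restricts-to : ∀ k → τ ⟨$⟩ʳ inject₁ k ≡ inject₁ (σ ⟨$⟩ʳ k)
    signs-agree  : ∀ k → ε' (inject₁ k) ≡ δ k

  fixes-lastˡ : τ ⟨$⟩ˡ fromℕ n ≡ fromℕ n
  fixes-lastˡ = trans (cong (τ ⟨$⟩ˡ_) (sym fixes-last)) (inverseˡ τ)

  restricts-toˡ : ∀ k → τ ⟨$⟩ˡ inject₁ k ≡ inject₁ (σ ⟨$⟩ˡ k)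
  restricts-toˡ k = begin
    τ ⟨$⟩ˡ inject₁ k                          ≡⟨ cong (λ i → τ ⟨$⟩ˡ inject₁ i) (inverseʳ σ) ⟨
    τ ⟨$⟩ˡ inject₁ (σ ⟨$⟩ʳ (σ ⟨$⟩ˡ k))        ≡⟨ cong (τ ⟨$⟩ˡ_) (restricts-to (σ ⟨$⟩ˡ k)) ⟨
    τ ⟨$⟩ˡ (τ ⟨$⟩ʳ inject₁ (σ ⟨$⟩ˡ k))        ≡⟨ inverseˡ τ ⟩
    inject₁ (σ ⟨$⟩ˡ k)                        ∎

monomialAct-∷ʳ : ∀ {n τ ε'} {σ : Permutation′ n} {δ} → Extends τ ε' σ δ →
  ∀ c → monomialAct τ ε' (c ∷ʳ z0) ≡ monomialAct σ δ c ∷ʳ z0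
monomialAct-∷ʳ {n} {τ} {ε'} {σ} {δ} E c = word-ext λ j →
  trans (lookup-monomialAct τ ε' (c ∷ʳ z0) j) (coordinate j (lastView j))
  where
  open Extends E
  coordinate : ∀ j → LastView j →
    applySign (ε' (τ ⟨$⟩ˡ j)) (lookup (c ∷ʳ z0) (τ ⟨$⟩ˡ j)) ≡ lookup (monomialAct σ δ c ∷ʳ z0) j
  coordinate _ last = begin
    applySign (ε' (τ ⟨$⟩ˡ fromℕ n)) (lookup (c ∷ʳ z0) (τ ⟨$⟩ˡ fromℕ n))
      ≡⟨ cong (applySign (ε' (τ ⟨$⟩ˡ fromℕ n)) ∘ lookup (c ∷ʳ z0)) fixes-lastˡ ⟩
    applySign (ε' (τ ⟨$⟩ˡ fromℕ n)) (lookup (c ∷ʳ z0) (fromℕ n))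
      ≡⟨ cong (applySign (ε' (τ ⟨$⟩ˡ fromℕ n))) (lookup-∷ʳ-last c z0) ⟩
    applySign (ε' (τ ⟨$⟩ˡ fromℕ n)) z0
      ≡⟨ applySign-zero (ε' (τ ⟨$⟩ˡ fromℕ n)) ⟩
    z0
      ≡⟨ lookup-∷ʳ-last (monomialAct σ δ c) z0 ⟨
    lookup (monomialAct σ δ c ∷ʳ z0) (fromℕ n) ∎
  coordinate _ (inner k) = begin
    applySign (ε' (τ ⟨$⟩ˡ inject₁ k)) (lookup (c ∷ʳ z0) (τ ⟨$⟩ˡ inject₁ k))
      ≡⟨ cong (λ i → applySign (ε' i) (lookup (c ∷ʳ z0) i)) (restricts-toˡ k) ⟩
    applySign (ε' (inject₁ (σ ⟨$⟩ˡ k))) (lookup (c ∷ʳ z0) (inject₁ (σ ⟨$⟩ˡ k)))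
      ≡⟨ cong₂ applySign (signs-agree (σ ⟨$⟩ˡ k)) (lookup-∷ʳ-inject₁ c z0 (σ ⟨$⟩ˡ k)) ⟩
    applySign (δ (σ ⟨$⟩ˡ k)) (lookup c (σ ⟨$⟩ˡ k))
      ≡⟨ lookup-monomialAct σ δ c k ⟨
    lookup (monomialAct σ δ c) k
      ≡⟨ lookup-∷ʳ-inject₁ (monomialAct σ δ c) z0 k ⟨
    lookup (monomialAct σ δ c ∷ʳ z0) (inject₁ k) ∎

realises-ext : ∀ {n τ ε'} {σ : Permutation′ n} {δ} {C C' : Pred (Word n) 0ℓ} → Extends τ ε' σ δ →
  Realises σ δ C C' ⇔ Realises τ ε' (ext C) (ext C')
realises-ext {τ = τ} {ε'} {σ} {δ} {C} {C'} E = mk⇔ extend restrict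
  where
  act-∷ʳ = monomialAct-∷ʳ E

  extend : Realises σ δ C C' → Realises τ ε' (ext C) (ext C')
  extend h y = mk⇔
    (λ { (c' , C'c' , refl) → let (c , Cc , c'≡) = preimage σ δ h C'c' in
         c ∷ʳ z0 , (c , Cc , refl) , trans (cong (_∷ʳ z0) c'≡) (sym (act-∷ʳ c)) })
    (λ { (_ , (c , Cc , refl) , refl) → monomialAct σ δ c , image σ δ h Cc , act-∷ʳ c })

  restrict : Realises τ ε' (ext C) (ext C') → Realises σ δ C C'
  restrict h y = mk⇔
    (λ C'y → restrictPreimage (preimage τ ε' h (y , C'y , refl)))
    (λ { (c , Cc , refl) → let (c' , C'c' , c'≡) = image τ ε' h (c , Cc , refl) in
       subst C' (∷ʳ-injectiveˡ _ _ (trans (sym c'≡) (act-∷ʳ c))) C'c' })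
    where
    restrictPreimage : (∃ λ v → ext C v × y ∷ʳ z0 ≡ monomialAct τ ε' v) →
      ∃ λ c → C c × y ≡ monomialAct σ δ c
    restrictPreimage (_ , (c , Cc , refl) , y≡) = c , Cc , ∷ʳ-injectiveˡ _ _ (trans y≡ (act-∷ʳ c))

extendSigns : ∀ {n} → (Fin n → Bool) → Fin (suc n) → Bool
extendSigns {zero}  δ zero    = false
extendSigns {suc n} δ zero    = δ zero
extendSigns {suc n} δ (suc i) = extendSigns (δ ∘ suc) i

extendSigns-inject₁ : ∀ {n} (δ : Fin n → Bool) k → extendSigns δ (inject₁ k) ≡ δ k
extendSigns-inject₁ {suc n} δ zero    = refl
extendSigns-inject₁ {suc n} δ (suc k) = extendSigns-inject₁ (δ ∘ suc) k

insert-extends : ∀ {n} (σ : Permutation′ n) δ →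
  Extends (insert (fromℕ n) (fromℕ n) σ) (extendSigns δ) σ δ
insert-extends {n} σ δ = record
  { fixes-last   = fixes-last
  ; restricts-to = λ k → begin
      τ ⟨$⟩ʳ inject₁ k                  ≡⟨ cong (τ ⟨$⟩ʳ_) (punchIn-last k) ⟨
      τ ⟨$⟩ʳ punchIn (fromℕ n) k        ≡⟨ insert-punchIn (fromℕ n) (fromℕ n) σ k ⟩
      punchIn (fromℕ n) (σ ⟨$⟩ʳ k)      ≡⟨ punchIn-last (σ ⟨$⟩ʳ k) ⟩
      inject₁ (σ ⟨$⟩ʳ k)                ∎
  ; signs-agree  = extendSigns-inject₁ δ
  }
  where
  τ = insert (fromℕ n) (fromℕ n) σ
  fixes-last : τ ⟨$⟩ʳ fromℕ n ≡ fromℕ n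
  fixes-last with fromℕ n ≟ fromℕ n
  ... | yes _ = refl
  ... | no ≢ = contradiction refl ≢

remove-extends : ∀ {n} (τ : Permutation′ (suc n)) ε' → τ ⟨$⟩ʳ fromℕ n ≡ fromℕ n →
  Extends τ ε' (remove (fromℕ n) τ) (ε' ∘ inject₁)
remove-extends {n} τ ε' τL≡L = record
  { fixes-last   = τL≡L
  ; restricts-to = λ k → begin
      τ ⟨$⟩ʳ inject₁ k                                ≡⟨ cong (τ ⟨$⟩ʳ_) (punchIn-last k) ⟨
      τ ⟨$⟩ʳ punchIn (fromℕ n) k                      ≡⟨ punchIn-permute τ (fromℕ n) k ⟩
      punchIn (τ ⟨$⟩ʳ fromℕ n) (σ ⟨$⟩ʳ k)             ≡⟨ cong (λ i → punchIn i (σ ⟨$⟩ʳ k)) τL≡L ⟩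
      punchIn (fromℕ n) (σ ⟨$⟩ʳ k)                    ≡⟨ punchIn-last (σ ⟨$⟩ʳ k) ⟩
      inject₁ (σ ⟨$⟩ʳ k)                              ∎
  ; signs-agree  = λ _ → refl
  }
  where σ = remove (fromℕ n) τ

-- An equivalence between trivial extensions can be chosen to fix the last coordinate:
-- compose with the transposition of the last coordinate and its preimage, on both
-- of which every word of ext C vanishes.
fixing-last : ∀ {n} {C C' : Pred (Word n) 0ℓ} π ε → Realises π ε (ext C) (ext C') →
  Σ (Permutation′ (suc n)) λ τ → Σ (Fin (suc n) → Bool) λ ε' →
    (τ ⟨$⟩ʳ fromℕ n ≡ fromℕ n) × Realises τ ε' (ext C) (ext C')
fixing-last {n} π ε h = τ , ε ∘ (swap ⟨$⟩ʳ_) , τL≡L ,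
  realises-agree π ε τ (ε ∘ (swap ⟨$⟩ʳ_))
    (λ v Cv → monomialAct-swap π ε a L v
      (trans (realised-vanishing π ε h L ext-vanishes v Cv) (sym (ext-vanishes v Cv))))
    h
  where
  L = fromℕ n
  a = π ⟨$⟩ˡ L
  swap = transpose a L
  τ = swap ∘ₚ π
  τL≡L : τ ⟨$⟩ʳ L ≡ L
  τL≡L = begin
    τ ⟨$⟩ʳ L                          ≡⟨ cong (τ ⟨$⟩ʳ_) (transpose-second L a) ⟨
    τ ⟨$⟩ʳ (τ ⟨$⟩ˡ L)                 ≡⟨ inverseʳ τ ⟩
    L                                 ∎

ext-preserves-≅ : ∀ {n} {C C' : Pred (Word n) 0ℓ} → C ≅ C' → ext C ≅ ext C'
ext-preserves-≅ {n} (σ , δ , h) =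
  insert (fromℕ n) (fromℕ n) σ , extendSigns δ , to (realises-ext (insert-extends σ δ)) h

ext-reflects-≅ : ∀ {n} {C C' : Pred (Word n) 0ℓ} → ext C ≅ ext C' → C ≅ C'
ext-reflects-≅ {n} (π , ε , h) =
  let (τ , ε' , τL≡L , h') = fixing-last π ε h in
  remove (fromℕ n) τ , ε' ∘ inject₁ , from (realises-ext (remove-extends τ ε' τL≡L)) h'

lemma3p1 : (n : ℕ) → 1 ≤ n →
    (C C' : Pred (Word n) 0ℓ) → IsZ4Code C → IsZ4Code C' →
    (D D' : Pred (Word (suc n)) 0ℓ) → IsZ4Code D → IsZ4Code D' →
    ext C ≅ D → ext C' ≅ D' →
    (C ≅ C') ⇔ (D ≅ D')
lemma3p1 n _ C C' _ _ D D' _ _ C≅D C'≅D' = mk⇔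
  (λ C≅C' → ≅-trans (≅-sym C≅D) (≅-trans (ext-preserves-≅ C≅C') C'≅D'))
  (λ D≅D' → ext-reflects-≅ (≅-trans C≅D (≅-trans D≅D' (≅-sym C'≅D'))))
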